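{- For every $n\ge0$, $\#\mathrm{Av}_n([1234],[1243],[1342])=\#\mathrm{Av}_n([1243],[1342],[1432])$. Moreover, for $n\ge5$, $\#\mathrm{Av}_n([1234],[1243],[1342])=2$.
   Context: For a linear permutation $\pi=\pi_1\ldots\pi_n$ of $[n]$, the cyclic permutation $[\pi]$ is the set of all rotations of $\pi$. A linear permutation $\sigma$ contains $\pi$ if some subsequence of $\sigma$ is order isomorphic to $\pi$ (same relative order). A cyclic permutation $[\sigma]$ contains $[\pi]$ if some rotation of $\sigma$ contains $\pi$; otherwise it avoids $[\pi]$. For a set of cyclic patterns $[\Pi]$, $\mathrm{Av}_n[\Pi]$ denotes the set of cyclic permutations of length $n$ avoiding every pattern in $[\Pi]$. -}

module Defs where

open import Data.Nat using (ℕ; _<_)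
open import Data.List using (List; []; _∷_; length; lookup; upTo; drop; take; _++_)
open import Data.List.Relation.Binary.Sublist.Propositional using (_⊆_)
open import Data.List.Relation.Binary.Permutation.Propositional using (_↭_)
open import Data.List.Relation.Unary.All using (All)
open import Data.List.Relation.Unary.Any using (Any)
open import Data.List.Relation.Unary.AllPairs using (AllPairs)
open import Data.Fin using (Fin; cast)
open import Data.Product using (Σ; ∃; _×_)
open import Relation.Binary.PropositionalEquality using (_≡_)
open import Relation.Nullary using (¬_)
open import Function.Bundles using (_⇔_)

-- A linear permutation of [n], written 0-based: a rearrangement of 0,1,…,n-1.
IsPerm : ℕ → List ℕ → Set
IsPerm n σ = σ ↭ upTo n

OrderIso : List ℕ → List ℕ → Set
OrderIso xs ys =
  Σ (length xs ≡ length ys) λ eq →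
    ∀ (i j : Fin (length xs)) →
      (lookup xs i < lookup xs j) ⇔ (lookup ys (cast eq i) < lookup ys (cast eq j))

Contains : List ℕ → List ℕ → Set
Contains σ π = ∃ λ τ → τ ⊆ σ × OrderIso τ π

rotate : ℕ → List ℕ → List ℕ
rotate k xs = drop k xs ++ take k xs

-- Two linear orderings represent the same cyclic permutation.
RotEq : List ℕ → List ℕ → Set
RotEq a b = ∃ λ k → rotate k a ≡ b

CycContains : List ℕ → List ℕ → Set
CycContains σ π = ∃ λ k → Contains (rotate k σ) π

CycAvoidsAll : List (List ℕ) → List ℕ → Set
CycAvoidsAll Π σ = All (λ π → ¬ CycContains σ π) Π

-- #Av_n[Π] = k : there is a list of k linear representatives of cyclic
-- permutations of length n avoiding [Π], pairwise in distinct rotation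
-- classes, such that every avoiding permutation of [n] is a rotation of one.
NumAv : List (List ℕ) → ℕ → ℕ → Set
NumAv Π n k =
  Σ (List (List ℕ)) λ L →
    length L ≡ k
    × All (IsPerm n) L
    × All (CycAvoidsAll Π) L
    × AllPairs (λ a b → ¬ RotEq a b) L
    × (∀ σ → IsPerm n σ → CycAvoidsAll Π σ → Any (RotEq σ) L)

p1234 p1243 p1342 p1432 : List ℕ
p1234 = 0 ∷ 1 ∷ 2 ∷ 3 ∷ []
p1243 = 0 ∷ 1 ∷ 3 ∷ 2 ∷ []
p1342 = 0 ∷ 2 ∷ 3 ∷ 1 ∷ []
p1432 = 0 ∷ 3 ∷ 2 ∷ 1 ∷ []

{-# OPTIONS --safe #-}

-- Rotate a cyclic permutation of [n] so that 0 comes first: σ ~ 0 τ. If it avoids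
-- [1234], [1243], [1342], then every subsequence x y z of τ has y < x (otherwise 0 x y z
-- is one of the patterns), and cyclic occurrences among four points of τ force every
-- 4-point subsequence of τ to have pattern 4321 or 3214. For n ≥ 5 this leaves only τ
-- decreasing, or decreasing followed by its maximum. For [1243], [1342], [1432] the same
-- two conditions hold for the reverse of τ, giving τ increasing or its maximum followed
-- by an increasing list. Conversely, each 4-point subsequence of a representative is an
-- increasing relabelling of one of finitely many shapes, and no shape is cyclically
-- order-isomorphic to a forbidden pattern: a finite computation, as are the cases n ≤ 4.
-- The two representatives of a class are told apart by a pattern only one of them contains.
module Submission where

open import Defs
open import Data.Empty using (⊥; ⊥-elim)
open import Data.Fin using (Fin; cast)
import Data.Fin as Fin
open import Data.Fin.Properties using (all?; cast-trans; cast-involutive; cast-is-id)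
open import Data.List
  using (List; []; _∷_; [_]; _++_; concatMap; reverse; length; lookup; map; take; drop; upTo; applyUpTo; applyDownFrom)
open import Data.List.Properties
  using ( ≡-dec; ++-assoc; ++-identityʳ; ∷-injective; take++drop≡id; take-all; drop-all; take-map; drop-map; map-++
        ; map-id; length-map; length-applyUpTo; applyUpTo-∷ʳ; reverse-++; reverse-involutive
        ; reverse-applyUpTo; reverse-applyDownFrom)
open import Data.List.Membership.Propositional using (_∈_; lose; find)
open import Data.List.Membership.Propositional.Properties
  using (∈-upTo⁺; ∈-++⁻; ∈-++⁺ʳ; ∈-applyDownFrom⁻; ∈-map⁺; ∈-map⁻; ∈-∃++; ∈-concatMap⁺; ∈-concatMap⁻)
open import Data.List.Relation.Binary.Equality.Propositional using (≋⇒≡)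
open import Data.List.Relation.Binary.Permutation.Propositional
  using (_↭_; ↭⇒↭ₛ; prep; swap; ↭-refl; ↭-sym; ↭-reflexive; ↭-trans)
open import Data.List.Relation.Binary.Permutation.Propositional.Properties
  using (++-comm; ↭-reverse; ↭-length; ↭-empty-inv; ¬x∷xs↭[]; ∷↭∷ʳ; ∈-resp-↭; drop-mid; drop-∷)
open import Data.List.Relation.Binary.Sublist.Propositional using (_⊆_; []; _∷_; _∷ʳ_; ⊆-refl; ⊆-trans)
open import Data.List.Relation.Binary.Sublist.Propositional.Properties
  using (++⁺; length-mono-≤; to-≋; []⊆-universal; All-resp-⊆; ∷ˡ⁻; reverse⁺)
open import Data.List.Relation.Unary.All using (All; []; _∷_)
import Data.List.Relation.Unary.All as All
import Data.List.Relation.Unary.All.Properties as AllP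
open import Data.List.Relation.Unary.AllPairs using (AllPairs; []; _∷_)
import Data.List.Relation.Unary.AllPairs as AllPairs
import Data.List.Relation.Unary.AllPairs.Properties as AllPairsP
open import Data.List.Relation.Unary.Any using (Any; here; there; any?; satisfied)
import Data.List.Relation.Unary.Any.Properties as AnyP
open import Data.List.Relation.Unary.Unique.Propositional using (Unique)
open import Data.List.Relation.Unary.Unique.Propositional.Properties using (upTo⁺)
open import Data.Nat using (ℕ; suc; _+_; _<_; _>_; _≤_; s≤s; z≤n; z<s; s<s; _≟_; _<?_; _≤?_)
open import Data.Nat.Properties
  using ( <-trans; <-≤-trans; ≤-trans; ≤-refl; <-irrefl; <-asym; <-cmp; <⇒≱; <⇒≤; ≰⇒>; n<1+n; n≢0⇒n>0
        ; m≤n⇒m<n∨m≡n; m≤n⇒∃[o]m+o≡n)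
open import Data.Product using (∃; ∃₂; _×_; _,_; proj₁; proj₂)
open import Data.Sum using (_⊎_; inj₁; inj₂)
import Data.Sum as Sum
open import Function using (id; _∘_; _⇔_; mk⇔; Equivalence)
import Function.Properties.Equivalence as ⇔
open import Relation.Binary using (tri<; tri≈; tri>)
open import Relation.Binary.PropositionalEquality
  using (_≡_; _≢_; refl; sym; trans; cong; cong₂; subst; subst₂; setoid; module ≡-Reasoning)
open import Data.List.Relation.Binary.Permutation.Setoid.Properties (setoid ℕ) using (Unique-resp-↭)
open import Relation.Nullary using (Dec; yes; no; ¬_; ¬?)
open import Relation.Nullary.Decidable using (map′; _×-dec_; _→-dec_; from-yes)
open import Relation.Unary using (Decidable)

rotate-++ : ∀ (xs ys : List ℕ) → rotate (length xs) (xs ++ ys) ≡ ys ++ xs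
rotate-++ xs ys = cong₂ _++_ (drop-++ xs) (take-++ xs)
  where
  drop-++ : ∀ xs → drop (length xs) (xs ++ ys) ≡ ys
  drop-++ []       = refl
  drop-++ (x ∷ xs) = drop-++ xs
  take-++ : ∀ xs → take (length xs) (xs ++ ys) ≡ xs
  take-++ []       = refl
  take-++ (x ∷ xs) = cong (x ∷_) (take-++ xs)

++-split : ∀ (us vs xs ys : List ℕ) → us ++ vs ≡ xs ++ ys →
           (∃ λ ws → xs ≡ us ++ ws × vs ≡ ws ++ ys) ⊎ (∃ λ ws → us ≡ xs ++ ws × ys ≡ ws ++ vs)
++-split []       vs xs       ys eq = inj₁ (xs , refl , eq)
++-split (u ∷ us) vs []       ys eq = inj₂ (u ∷ us , refl , sym eq)
++-split (u ∷ us) vs (x ∷ xs) ys eq with ∷-injective eq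
... | refl , eq′ = Sum.map (λ (ws , p , q) → ws , cong (u ∷_) p , q)
                           (λ (ws , p , q) → ws , cong (u ∷_) p , q)
                           (++-split us vs xs ys eq′)

rotate-rotate : ∀ j k (σ : List ℕ) → ∃ λ i → rotate j (rotate k σ) ≡ rotate i σ
rotate-rotate j k σ =
  let i , eq = swap-halves (take k σ) (drop k σ) (take j (rotate k σ)) (drop j (rotate k σ))
                           (take++drop≡id j (rotate k σ))
  in i , trans eq (cong (rotate i) (take++drop≡id k σ))
  where
  open ≡-Reasoning
  swap-halves : ∀ as bs us vs → us ++ vs ≡ bs ++ as → ∃ λ i → vs ++ us ≡ rotate i (as ++ bs)
  swap-halves as bs us vs eq with ++-split us vs bs as eq
  ... | inj₁ (ws , refl , refl) = length (as ++ us) , (begin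
    (ws ++ as) ++ us                              ≡⟨ ++-assoc ws as us ⟩
    ws ++ as ++ us                                ≡⟨ rotate-++ (as ++ us) ws ⟨
    rotate (length (as ++ us)) ((as ++ us) ++ ws) ≡⟨ cong (rotate (length (as ++ us))) (++-assoc as us ws) ⟩
    rotate (length (as ++ us)) (as ++ us ++ ws)   ∎)
  ... | inj₂ (ws , refl , refl) = length ws , (begin
    vs ++ bs ++ ws                        ≡⟨ ++-assoc vs bs ws ⟨
    (vs ++ bs) ++ ws                      ≡⟨ rotate-++ ws (vs ++ bs) ⟨
    rotate (length ws) (ws ++ vs ++ bs)   ≡⟨ cong (rotate (length ws)) (++-assoc ws vs bs) ⟨
    rotate (length ws) ((ws ++ vs) ++ bs) ∎)

rotEq-trans : ∀ {xs ys zs} → RotEq xs ys → RotEq ys zs → RotEq xs zs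
rotEq-trans {xs} (k , refl) (j , refl) with i , eq ← rotate-rotate j k xs = i , sym eq

rotate-↭ : ∀ k (xs : List ℕ) → rotate k xs ↭ xs
rotate-↭ k xs = ↭-trans (++-comm (drop k xs) (take k xs)) (↭-reflexive (take++drop≡id k xs))

rotate-map : ∀ (f : ℕ → ℕ) k xs → rotate k (map f xs) ≡ map f (rotate k xs)
rotate-map f k xs =
  trans (cong₂ _++_ (drop-map k xs) (take-map k xs)) (sym (map-++ f (drop k xs) (take k xs)))

rotate-≥ : ∀ k (xs : List ℕ) → length xs ≤ k → rotate k xs ≡ xs
rotate-≥ k xs len≤k = cong₂ _++_ (drop-all k xs len≤k) (take-all k xs len≤k)

module _ {P : List ℕ → Set} (P? : Decidable P) where

  anyRotation? : ∀ xs → Dec (∃ λ k → P (rotate k xs))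
  anyRotation? xs = map′ satisfied bounded (any? (λ k → P? (rotate k xs)) (upTo (suc (length xs))))
    where
    bounded : (∃ λ k → P (rotate k xs)) → Any (λ k → P (rotate k xs)) (upTo (suc (length xs)))
    bounded (k , p) with k ≤? length xs
    ... | yes k≤len = lose (∈-upTo⁺ (s≤s k≤len)) p
    ... | no  k≰len = lose (∈-upTo⁺ ≤-refl)
      (subst P (trans (rotate-≥ k xs (<⇒≤ (≰⇒> k≰len))) (sym (rotate-≥ (length xs) xs ≤-refl))) p)

rotEq? : ∀ xs ys → Dec (RotEq xs ys)
rotEq? xs ys = anyRotation? (λ zs → ≡-dec _≟_ zs ys) xs

orderIso-refl : ∀ xs → OrderIso xs xs
orderIso-refl xs = refl , λ i j →
  subst₂ (λ i′ j′ → (lookup xs i < lookup xs j) ⇔ (lookup xs i′ < lookup xs j′))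
         (sym (cast-is-id refl i)) (sym (cast-is-id refl j)) ⇔.refl

orderIso-sym : ∀ {xs ys} → OrderIso xs ys → OrderIso ys xs
orderIso-sym {xs} {ys} (eq , iso) = sym eq , λ i j →
  ⇔.sym (subst₂ (λ i′ j′ → (lookup xs (cast (sym eq) i) < lookup xs (cast (sym eq) j)) ⇔
                             (lookup ys i′ < lookup ys j′))
                (cast-involutive eq (sym eq) i) (cast-involutive eq (sym eq) j)
                (iso (cast (sym eq) i) (cast (sym eq) j)))

orderIso-trans : ∀ {xs ys zs} → OrderIso xs ys → OrderIso ys zs → OrderIso xs zs
orderIso-trans {xs} {ys} {zs} (eq₁ , iso₁) (eq₂ , iso₂) = trans eq₁ eq₂ , λ i j →
  ⇔.trans (iso₁ i j)
    (subst₂ (λ i′ j′ → (lookup ys (cast eq₁ i) < lookup ys (cast eq₁ j)) ⇔ (lookup zs i′ < lookup zs j′))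
            (cast-trans eq₁ eq₂ i) (cast-trans eq₁ eq₂ j)
            (iso₂ (cast eq₁ i) (cast eq₁ j)))

_⇔-dec_ : ∀ {A B : Set} → Dec A → Dec B → Dec (A ⇔ B)
a? ⇔-dec b? = map′ (λ (to , from) → mk⇔ to from) (λ e → Equivalence.to e , Equivalence.from e)
                   ((a? →-dec b?) ×-dec (b? →-dec a?))

orderIso? : ∀ xs ys → Dec (OrderIso xs ys)
orderIso? xs ys with length xs ≟ length ys
... | no  len≢ = no (len≢ ∘ proj₁)
... | yes eq   = map′ (eq ,_) proj₂ (all? λ i → all? λ j →
  (lookup xs i <? lookup xs j) ⇔-dec (lookup ys (cast eq i) <? lookup ys (cast eq j)))

Increasing : (ℕ → ℕ) → Set
Increasing f = ∀ n → f n < f (suc n)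

increasing-< : ∀ {f} → Increasing f → ∀ {x y} → x < y → f x < f y
increasing-< inc {x} {suc y} (s≤s x≤y) with m≤n⇒m<n∨m≡n x≤y
... | inj₁ x<y  = <-trans (increasing-< inc x<y) (inc y)
... | inj₂ refl = inc x

increasing-⇔ : ∀ {f} → Increasing f → ∀ x y → (f x < f y) ⇔ (x < y)
increasing-⇔ {f} inc x y = mk⇔ reflects (increasing-< inc)
  where
  reflects : f x < f y → x < y
  reflects fx<fy with <-cmp x y
  ... | tri< x<y _ _  = x<y
  ... | tri≈ _ refl _ = ⊥-elim (<-irrefl refl fx<fy)
  ... | tri> _ _ y<x  = ⊥-elim (<-asym fx<fy (increasing-< inc y<x))

lookup-map : ∀ (f : ℕ → ℕ) xs (i : Fin (length (map f xs))) →
             lookup (map f xs) i ≡ f (lookup xs (cast (length-map f xs) i))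
lookup-map f (x ∷ xs) Fin.zero    = refl
lookup-map f (x ∷ xs) (Fin.suc i) = lookup-map f xs i

map-orderIso : ∀ {f} → Increasing f → ∀ xs → OrderIso (map f xs) xs
map-orderIso {f} inc xs = length-map f xs , λ i j →
  subst₂ (λ a b → (a < b) ⇔ (lookup xs (cast (length-map f xs) i) < lookup xs (cast (length-map f xs) j)))
         (sym (lookup-map f xs i)) (sym (lookup-map f xs j)) (increasing-⇔ inc _ _)

Relabelling : List ℕ → List ℕ → Set
Relabelling xs w = ∃ λ f → Increasing f × xs ≡ map f w

relabelling-orderIso : ∀ {xs w} → Relabelling xs w → OrderIso xs w
relabelling-orderIso {w = w} (f , inc , refl) = map-orderIso {f} inc w

-- The last clause makes ladder a b c d 3 reduce to d, so that a relabelling of an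
-- explicit quadruple by ladder holds by refl.
ladder : ℕ → ℕ → ℕ → ℕ → ℕ → ℕ
ladder a b c d 0                   = a
ladder a b c d 1                   = b
ladder a b c d 2                   = c
ladder a b c d (suc (suc (suc n))) = n + d

ladder-relabelling : ∀ {a b c d w} → a < b → b < c → c < d → Relabelling (map (ladder a b c d) w) w
ladder-relabelling {a} {b} {c} {d} a<b b<c c<d = ladder a b c d , increasing , refl
  where
  increasing : Increasing (ladder a b c d)
  increasing 0                   = a<b
  increasing 1                   = b<c
  increasing 2                   = c<d
  increasing (suc (suc (suc n))) = n<1+n (n + d)

-- Cyclic containment through subsequences

CycIso : List ℕ → List ℕ → Set
CycIso τ π = ∃ λ k → OrderIso (rotate k τ) π

cycIso? : ∀ τ π → Dec (CycIso τ π)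
cycIso? τ π = anyRotation? (λ ρ → orderIso? ρ π) τ

length-cycIso : ∀ {τ π} → CycIso τ π → length τ ≡ length π
length-cycIso {τ} (k , eq , _) = trans (sym (↭-length (rotate-↭ k τ))) eq

relabelling-cycIso : ∀ {τ w π} → Relabelling τ w → CycIso τ π → CycIso w π
relabelling-cycIso {w = w} {π} (f , inc , refl) (k , iso) =
  k , orderIso-trans {rotate k w} {rotate k (map f w)} {π} w≅fw iso
  where
  w≅fw : OrderIso (rotate k w) (rotate k (map f w))
  w≅fw = subst (OrderIso (rotate k w)) (sym (rotate-map f k w))
               (orderIso-sym {map f (rotate k w)} {rotate k w} (map-orderIso {f} inc (rotate k w)))

⊆-++-split : ∀ xs {ys τ : List ℕ} → τ ⊆ xs ++ ys → ∃₂ λ τ₁ τ₂ → τ ≡ τ₁ ++ τ₂ × τ₁ ⊆ xs × τ₂ ⊆ ys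
⊆-++-split []       p = [] , _ , refl , [] , p
⊆-++-split (x ∷ xs) (.x ∷ʳ p) with τ₁ , τ₂ , refl , p₁ , p₂ ← ⊆-++-split xs p =
  τ₁ , τ₂ , refl , x ∷ʳ p₁ , p₂
⊆-++-split (x ∷ xs) (refl ∷ p) with τ₁ , τ₂ , refl , p₁ , p₂ ← ⊆-++-split xs p =
  x ∷ τ₁ , τ₂ , refl , refl ∷ p₁ , p₂

++-⊆-split : ∀ τ₁ {τ₂ σ : List ℕ} → τ₁ ++ τ₂ ⊆ σ → ∃₂ λ xs ys → σ ≡ xs ++ ys × τ₁ ⊆ xs × τ₂ ⊆ ys
++-⊆-split []       p = [] , _ , refl , [] , p
++-⊆-split (t ∷ τ₁) (y ∷ʳ p) with xs , ys , refl , p₁ , p₂ ← ++-⊆-split (t ∷ τ₁) p =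
  y ∷ xs , ys , refl , y ∷ʳ p₁ , p₂
++-⊆-split (t ∷ τ₁) (refl ∷ p) with xs , ys , refl , p₁ , p₂ ← ++-⊆-split τ₁ p =
  t ∷ xs , ys , refl , refl ∷ p₁ , p₂

cycContains-intro : ∀ {τ σ π} → τ ⊆ σ → CycIso τ π → CycContains σ π
cycContains-intro {τ} τ⊆σ (k , iso)
  with xs , ys , refl , p₁ , p₂ ← ++-⊆-split (take k τ) (subst (_⊆ _) (sym (take++drop≡id k τ)) τ⊆σ) =
  length xs , rotate k τ , subst (rotate k τ ⊆_) (sym (rotate-++ xs ys)) (++⁺ p₂ p₁) , iso

cycContains-elim : ∀ {σ π} → CycContains σ π → ∃ λ τ → τ ⊆ σ × CycIso τ π
cycContains-elim {σ} {π} (k , ρ , ρ⊆ , iso) with τ₁ , τ₂ , refl , p₁ , p₂ ← ⊆-++-split (drop k σ) ρ⊆ =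
  τ₂ ++ τ₁ , subst (τ₂ ++ τ₁ ⊆_) (take++drop≡id k σ) (++⁺ p₂ p₁) ,
  length τ₂ , subst (λ ρ → OrderIso ρ π) (sym (rotate-++ τ₂ τ₁)) iso

cycContains-rotate : ∀ k {σ π} → CycContains (rotate k σ) π → CycContains σ π
cycContains-rotate k {σ} {π} (j , c) with i , eq ← rotate-rotate j k σ = i , subst (λ ρ → Contains ρ π) eq c

cycContains-self : ∀ π → CycContains π π
cycContains-self π =
  cycContains-intro {π = π} ⊆-refl (0 , subst (λ ρ → OrderIso ρ π) (sym (++-identityʳ π)) (orderIso-refl π))

rotEq-cycContains : ∀ {σ π} → RotEq σ π → CycContains σ π
rotEq-cycContains {π = π} (k , refl) = cycContains-rotate k {π = π} (cycContains-self π)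

avoids-rotate : ∀ {Π σ ρ} k → rotate k σ ≡ ρ → CycAvoidsAll Π σ → CycAvoidsAll Π ρ
avoids-rotate k refl = All.map λ {π} ¬c c → ¬c (cycContains-rotate k {π = π} c)

distinct-by-pattern : ∀ {xs ys π} → ¬ CycContains xs π → CycContains ys π → ¬ RotEq xs ys
distinct-by-pattern {π = π} ¬c c (k , refl) = ¬c (cycContains-rotate k {π = π} c)

short-avoids : ∀ {σ π} → length σ < length π → ¬ CycContains σ π
short-avoids {σ} {π} σ<π c with τ , τ⊆σ , iso ← cycContains-elim {π = π} c =
  <⇒≱ σ<π (subst (_≤ length σ) (length-cycIso {π = π} iso) (length-mono-≤ τ⊆σ))

occurs : ∀ {τ ρ π} k → τ ⊆ ρ → Relabelling (rotate k τ) π → CycContains ρ π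
occurs {π = π} k τ⊆ρ r = cycContains-intro {π = π} τ⊆ρ (k , relabelling-orderIso r)

QuadShapes : List (List ℕ) → List ℕ → Set
QuadShapes W ρ = ∀ {a b c d} → a ∷ b ∷ c ∷ d ∷ [] ⊆ ρ → Any (Relabelling (a ∷ b ∷ c ∷ d ∷ [])) W

ShapesAvoid : List (List ℕ) → List (List ℕ) → Set
ShapesAvoid W Π = All (λ π → length π ≡ 4 × All (λ w → ¬ CycIso w π) W) Π

shapesAvoid? : ∀ W Π → Dec (ShapesAvoid W Π)
shapesAvoid? W = All.all? λ π → (length π ≟ 4) ×-dec All.all? (λ w → ¬? (cycIso? w π)) W

quadShapes-avoid : ∀ {W ρ Π} → QuadShapes W ρ → ShapesAvoid W Π → CycAvoidsAll Π ρ
quadShapes-avoid {W} {ρ} shapes = All.map λ {π} (len≡4 , free) c →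
  let τ , τ⊆ρ , iso = cycContains-elim {π = π} c
  in quad {π} τ τ⊆ρ iso free (trans (length-cycIso {π = π} iso) len≡4)
  where
  quad : ∀ {π} τ → τ ⊆ ρ → CycIso τ π → All (λ w → ¬ CycIso w π) W → length τ ≡ 4 → ⊥
  quad {π} (a ∷ b ∷ c ∷ d ∷ []) τ⊆ρ iso free _ with ¬iso , r ← All.lookupAny free (shapes τ⊆ρ) =
    ¬iso (relabelling-cycIso {π = π} r iso)
  quad []                      _ _ _ ()
  quad (_ ∷ [])                _ _ _ ()
  quad (_ ∷ _ ∷ [])            _ _ _ ()
  quad (_ ∷ _ ∷ _ ∷ [])        _ _ _ ()
  quad (_ ∷ _ ∷ _ ∷ _ ∷ _ ∷ _) _ _ _ ()

module _ {A : Set} where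

  insertions : A → List A → List (List A)
  insertions x []       = [ [ x ] ]
  insertions x (y ∷ ys) = (x ∷ y ∷ ys) ∷ map (y ∷_) (insertions x ys)

  permutations : List A → List (List A)
  permutations []       = [ [] ]
  permutations (x ∷ xs) = concatMap (insertions x) (permutations xs)

  ∈-insertions : ∀ x us vs → us ++ x ∷ vs ∈ insertions x (us ++ vs)
  ∈-insertions x []       []       = here refl
  ∈-insertions x []       (v ∷ vs) = here refl
  ∈-insertions x (u ∷ us) vs       = there (∈-map⁺ (u ∷_) (∈-insertions x us vs))

  insertions-↭ : ∀ {x ys} zs → ys ∈ insertions x zs → ys ↭ x ∷ zs
  insertions-↭ []       (here refl) = ↭-refl
  insertions-↭ (z ∷ zs) (here refl) = ↭-refl
  insertions-↭ {x} (z ∷ zs) (there p) with ys , q , refl ← ∈-map⁻ (z ∷_) p =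
    ↭-trans (prep z (insertions-↭ zs q)) (swap z x ↭-refl)

  ∈-permutations : ∀ xs {ys} → ys ↭ xs → ys ∈ permutations xs
  ∈-permutations []       p = here (↭-empty-inv p)
  ∈-permutations (x ∷ xs) p with us , vs , refl ← ∈-∃++ (∈-resp-↭ (↭-sym p) (here refl)) =
    ∈-concatMap⁺ (insertions x) (lose (∈-permutations xs (drop-mid us [] p)) (∈-insertions x us vs))

  permutations-↭ : ∀ xs {ys} → ys ∈ permutations xs → ys ↭ xs
  permutations-↭ []       (here refl) = ↭-refl
  permutations-↭ (x ∷ xs) p with zs , zs∈ , ys∈ ← find (∈-concatMap⁻ (insertions x) p) =
    ↭-trans (insertions-↭ zs ys∈) (prep x (permutations-↭ xs zs∈))

rotate-to-0 : ∀ {m σ} → IsPerm (suc m) σ → ∃₂ λ k τ → rotate k σ ≡ 0 ∷ τ × τ ↭ applyUpTo suc m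
rotate-to-0 p with us , vs , refl ← ∈-∃++ (∈-resp-↭ (↭-sym p) (here refl)) =
  length us , vs ++ us , rotate-++ us (0 ∷ vs) , drop-∷ (↭-trans (++-comm (0 ∷ vs) us) p)

rotEq-permutations : ∀ {m σ} → IsPerm (suc m) σ → Any (λ τ → RotEq σ (0 ∷ τ)) (permutations (applyUpTo suc m))
rotEq-permutations {m} p with k , τ , e , τ↭ ← rotate-to-0 p = lose (∈-permutations (applyUpTo suc m) τ↭) (k , e)

unique-0∷ : ∀ {m τ} → τ ↭ applyUpTo suc m → Unique (0 ∷ τ)
unique-0∷ {m} p = Unique-resp-↭ (↭⇒↭ₛ (↭-sym (prep 0 p))) (upTo⁺ (suc m))

applyUpTo↭applyDownFrom : ∀ n → applyUpTo suc n ↭ applyDownFrom suc n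
applyUpTo↭applyDownFrom n =
  ↭-trans (↭-sym (↭-reverse (applyUpTo suc n))) (↭-reflexive (reverse-applyUpTo suc n))

-- Lists whose 4-point patterns are 4321 or 3214

NearlyDecreasing : List ℕ → Set
NearlyDecreasing τ = ∀ {a b c d} → a ∷ b ∷ c ∷ d ∷ [] ⊆ τ → b < a × c < b × (d < c ⊎ a < d)

DecreasingThenMax : List ℕ → Set
DecreasingThenMax τ = ∃₂ λ D z → τ ≡ D ++ [ z ] × AllPairs _>_ D × All (_< z) D

decreasing-∷ : ∀ {a b xs} → b < a → AllPairs _>_ (b ∷ xs) → AllPairs _>_ (a ∷ b ∷ xs)
decreasing-∷ b<a dec@(b>xs ∷ _) = (b<a ∷ All.map (λ x<b → <-trans x<b b<a) b>xs) ∷ dec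

nearlyDecreasing-shape : ∀ a b c d rest → NearlyDecreasing (a ∷ b ∷ c ∷ d ∷ rest) →
  AllPairs _>_ (a ∷ b ∷ c ∷ d ∷ rest) ⊎ DecreasingThenMax (a ∷ b ∷ c ∷ d ∷ rest)
nearlyDecreasing-shape a b c d [] nd with nd ⊆-refl
... | b<a , c<b , inj₁ d<c = inj₁ (decreasing-∷ b<a (decreasing-∷ c<b ((d<c ∷ []) ∷ [] ∷ [])))
... | b<a , c<b , inj₂ a<d =
  inj₂ (a ∷ b ∷ c ∷ [] , d , refl , decreasing-∷ b<a ((c<b ∷ []) ∷ [] ∷ []) ,
        a<d ∷ <-trans b<a a<d ∷ <-trans (<-trans c<b b<a) a<d ∷ [])
nearlyDecreasing-shape a b c d (e ∷ rest) nd with nearlyDecreasing-shape b c d e rest (nd ∘ (a ∷ʳ_))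
... | inj₁ dec = inj₁ (decreasing-∷ (proj₁ (nd (refl ∷ refl ∷ refl ∷ refl ∷ []⊆-universal (e ∷ rest)))) dec)
... | inj₂ (y₁ ∷ y₂ ∷ D , z , eq , dec , D<z@(_ ∷ y₂<z ∷ _))
  with nd (refl ∷ subst (y₁ ∷ y₂ ∷ z ∷ [] ⊆_) (sym eq) (refl ∷ refl ∷ ++⁺ ([]⊆-universal D) (refl ∷ [])))
...   | _ , _ , inj₁ z<y₂ = ⊥-elim (<-asym z<y₂ y₂<z)
...   | y₁<a , _ , inj₂ a<z = inj₂ (a ∷ y₁ ∷ y₂ ∷ D , z , cong (a ∷_) eq , decreasing-∷ y₁<a dec , a<z ∷ D<z)
nearlyDecreasing-shape a b c d (e ∷ rest) nd | inj₂ ([] , _ , () , _)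
nearlyDecreasing-shape a b c d (e ∷ rest) nd | inj₂ (_ ∷ [] , _ , () , _)

decreasing-↭-unique : ∀ {xs ys} → AllPairs _>_ xs → AllPairs _>_ ys → xs ↭ ys → xs ≡ ys
decreasing-↭-unique []      _  p = sym (↭-empty-inv (↭-sym p))
decreasing-↭-unique (_ ∷ _) [] p = ⊥-elim (¬x∷xs↭[] p)
decreasing-↭-unique {x ∷ xs} (x>xs ∷ dxs) (y>ys ∷ dys) p
  with ∈-resp-↭ p (here refl) | ∈-resp-↭ (↭-sym p) (here refl)
... | here refl  | _          = cong (x ∷_) (decreasing-↭-unique dxs dys (drop-∷ p))
... | there x∈ys | here refl  = ⊥-elim (<-irrefl refl (All.lookup y>ys x∈ys))
... | there x∈ys | there y∈xs = ⊥-elim (<-asym (All.lookup y>ys x∈ys) (All.lookup x>xs y∈xs))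

decreasing-applyDownFrom : ∀ n → AllPairs _>_ (applyDownFrom suc n)
decreasing-applyDownFrom n = AllPairsP.applyDownFrom⁺₁ suc n (λ j<i _ → s<s j<i)

decreasingThenMax-↭ : ∀ {m D z} → D ++ [ z ] ↭ applyDownFrom suc (suc m) → AllPairs _>_ D → All (_< z) D →
                      D ++ [ z ] ≡ applyDownFrom suc m ++ [ suc m ]
decreasingThenMax-↭ {m} {D} {z} p dec D<z with top≡z
  where
  top≡z : suc m ≡ z
  top≡z with ∈-++⁻ D (∈-resp-↭ (↭-sym p) (here refl))
  ... | inj₂ (here top≡z) = top≡z
  ... | inj₁ top∈D with i , i<top , refl ← ∈-applyDownFrom⁻ suc (∈-resp-↭ p (∈-++⁺ʳ D (here refl))) =
    ⊥-elim (<⇒≱ (All.lookup D<z top∈D) i<top)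
... | refl = cong (_++ [ suc m ])
  (decreasing-↭-unique dec (decreasing-applyDownFrom m) (drop-∷ (↭-trans (∷↭∷ʳ (suc m) D) p)))

nearlyDecreasing-classify : ∀ {j τ} → τ ↭ applyDownFrom suc (4 + j) → NearlyDecreasing τ →
  τ ≡ applyDownFrom suc (4 + j) ⊎ τ ≡ applyDownFrom suc (3 + j) ++ [ 4 + j ]
nearlyDecreasing-classify {j} {a ∷ b ∷ c ∷ d ∷ rest} p nd with nearlyDecreasing-shape a b c d rest nd
... | inj₁ dec = inj₁ (decreasing-↭-unique dec (decreasing-applyDownFrom (4 + j)) p)
... | inj₂ (D , z , eq , dec , D<z) =
  inj₂ (trans eq (decreasingThenMax-↭ {3 + j} (subst (_↭ applyDownFrom suc (4 + j)) eq p) dec D<z))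
nearlyDecreasing-classify {τ = []}             p _ with () ← ↭-length p
nearlyDecreasing-classify {τ = _ ∷ []}         p _ with () ← ↭-length p
nearlyDecreasing-classify {τ = _ ∷ _ ∷ []}     p _ with () ← ↭-length p
nearlyDecreasing-classify {τ = _ ∷ _ ∷ _ ∷ []} p _ with () ← ↭-length p

-- Avoiders in normal form 0 ∷ τ

≢⇒<⊎> : ∀ {x y} → x ≢ y → x < y ⊎ y < x
≢⇒<⊎> {x} {y} x≢y with <-cmp x y
... | tri< x<y _ _ = inj₁ x<y
... | tri≈ _ x≡y _ = ⊥-elim (x≢y x≡y)
... | tri> _ _ y<x = inj₂ y<x

AllPairs-resp-⊆ : ∀ {R : ℕ → ℕ → Set} {xs ys} → xs ⊆ ys → AllPairs R ys → AllPairs R xs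
AllPairs-resp-⊆ []         []      = []
AllPairs-resp-⊆ (_ ∷ʳ p)   (_ ∷ r) = AllPairs-resp-⊆ p r
AllPairs-resp-⊆ (refl ∷ p) (h ∷ r) = All-resp-⊆ p h ∷ AllPairs-resp-⊆ p r

module _ {τ} (uniq : Unique (0 ∷ τ)) where

  private
    positive : ∀ {xs} → xs ⊆ τ → All (0 <_) xs
    positive q = All.map (λ 0≢x → n≢0⇒n>0 (0≢x ∘ sym)) (All-resp-⊆ q (AllPairs.head uniq))

    distinct : ∀ {xs} → xs ⊆ τ → Unique xs
    distinct q = AllPairs-resp-⊆ q (AllPairs.tail uniq)

    init₃ : ∀ {a b c d} → a ∷ b ∷ c ∷ d ∷ [] ⊆ τ → a ∷ b ∷ c ∷ [] ⊆ τ
    init₃ {d = d} = ⊆-trans (refl ∷ refl ∷ refl ∷ d ∷ʳ [])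

  module _ (¬c₁ : ¬ CycContains (0 ∷ τ) p1234) (¬c₂ : ¬ CycContains (0 ∷ τ) p1243)
           (¬c₃ : ¬ CycContains (0 ∷ τ) p1342) where

    descent : ∀ {x y z} → x ∷ y ∷ z ∷ [] ⊆ τ → y < x
    descent q with positive q | distinct q
    ... | 0<x ∷ _ ∷ 0<z ∷ [] | (x≢y ∷ x≢z ∷ []) ∷ (y≢z ∷ []) ∷ [] ∷ []
      with ≢⇒<⊎> x≢y | ≢⇒<⊎> x≢z | ≢⇒<⊎> y≢z
    ... | inj₂ y<x | _        | _        = y<x
    ... | inj₁ x<y | inj₂ z<x | _        = ⊥-elim (¬c₃ (occurs 0 (refl ∷ q) (ladder-relabelling 0<z z<x x<y)))
    ... | inj₁ x<y | inj₁ x<z | inj₂ z<y = ⊥-elim (¬c₂ (occurs 0 (refl ∷ q) (ladder-relabelling 0<x x<z z<y)))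
    ... | inj₁ x<y | inj₁ _   | inj₁ y<z = ⊥-elim (¬c₁ (occurs 0 (refl ∷ q) (ladder-relabelling 0<x x<y y<z)))

    avoids₁-nearlyDecreasing : NearlyDecreasing τ
    avoids₁-nearlyDecreasing {a} {b} {c} {d} q = b<a , c<b , last
      where
      b<a : b < a
      b<a = descent (init₃ q)
      c<b : c < b
      c<b = descent (∷ˡ⁻ q)
      last : d < c ⊎ a < d
      last with distinct q
      ... | (_ ∷ _ ∷ a≢d ∷ []) ∷ (_ ∷ b≢d ∷ []) ∷ (c≢d ∷ []) ∷ [] ∷ []
        with ≢⇒<⊎> c≢d | ≢⇒<⊎> a≢d | ≢⇒<⊎> b≢d
      ... | inj₂ d<c | _        | _        = inj₁ d<c
      ... | inj₁ _   | inj₁ a<d | _        = inj₂ a<d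
      ... | inj₁ _   | inj₂ d<a | inj₁ b<d = ⊥-elim (¬c₃ (occurs 2 (0 ∷ʳ q) (ladder-relabelling c<b b<d d<a)))
      ... | inj₁ c<d | inj₂ _   | inj₂ d<b = ⊥-elim (¬c₂ (occurs 2 (0 ∷ʳ q) (ladder-relabelling c<d d<b b<a)))

  module _ (¬c₂ : ¬ CycContains (0 ∷ τ) p1243) (¬c₃ : ¬ CycContains (0 ∷ τ) p1342)
           (¬c₄ : ¬ CycContains (0 ∷ τ) p1432) where

    ascent : ∀ {x y z} → x ∷ y ∷ z ∷ [] ⊆ τ → y < z
    ascent q with positive q | distinct q
    ... | 0<x ∷ _ ∷ 0<z ∷ [] | (x≢y ∷ x≢z ∷ []) ∷ (y≢z ∷ []) ∷ [] ∷ []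
      with ≢⇒<⊎> y≢z | ≢⇒<⊎> x≢z | ≢⇒<⊎> x≢y
    ... | inj₁ y<z | _        | _        = y<z
    ... | inj₂ z<y | inj₁ x<z | _        = ⊥-elim (¬c₂ (occurs 0 (refl ∷ q) (ladder-relabelling 0<x x<z z<y)))
    ... | inj₂ _   | inj₂ z<x | inj₁ x<y = ⊥-elim (¬c₃ (occurs 0 (refl ∷ q) (ladder-relabelling 0<z z<x x<y)))
    ... | inj₂ z<y | inj₂ _   | inj₂ y<x = ⊥-elim (¬c₄ (occurs 0 (refl ∷ q) (ladder-relabelling 0<z z<y y<x)))

    avoids₂-nearlyDecreasing : NearlyDecreasing (reverse τ)
    avoids₂-nearlyDecreasing {a} {b} {c} {d} q = b<a , c<b , last
      where
      q′ : d ∷ c ∷ b ∷ a ∷ [] ⊆ τ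
      q′ = subst (d ∷ c ∷ b ∷ a ∷ [] ⊆_) (reverse-involutive τ) (reverse⁺ q)
      b<a : b < a
      b<a = ascent (∷ˡ⁻ q′)
      c<b : c < b
      c<b = ascent (init₃ q′)
      last : d < c ⊎ a < d
      last with distinct q′
      ... | (d≢c ∷ d≢b ∷ d≢a ∷ []) ∷ _ ∷ _ ∷ [] ∷ []
        with ≢⇒<⊎> d≢c | ≢⇒<⊎> d≢a | ≢⇒<⊎> d≢b
      ... | inj₁ d<c | _        | _        = inj₁ d<c
      ... | inj₂ _   | inj₂ a<d | _        = inj₂ a<d
      ... | inj₂ c<d | inj₁ d<a | inj₁ d<b = ⊥-elim (¬c₃ (occurs 1 (0 ∷ʳ q′) (ladder-relabelling c<d d<b b<a)))
      ... | inj₂ _   | inj₁ d<a | inj₂ b<d = ⊥-elim (¬c₂ (occurs 1 (0 ∷ʳ q′) (ladder-relabelling c<b b<d d<a)))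

fallingShapes fallingTopShapes risingShapes risingTopShapes : List (List ℕ)
fallingShapes    = (0 ∷ 3 ∷ 2 ∷ 1 ∷ []) ∷ (3 ∷ 2 ∷ 1 ∷ 0 ∷ []) ∷ []
fallingTopShapes = (3 ∷ 0 ∷ 2 ∷ 1 ∷ []) ∷ fallingShapes
risingShapes     = [ 0 ∷ 1 ∷ 2 ∷ 3 ∷ [] ]
risingTopShapes  = (0 ∷ 3 ∷ 1 ∷ 2 ∷ []) ∷ (3 ∷ 0 ∷ 1 ∷ 2 ∷ []) ∷ risingShapes

decreasing-shapes : ∀ {xs} → AllPairs _>_ xs → QuadShapes [ 3 ∷ 2 ∷ 1 ∷ 0 ∷ [] ] xs
decreasing-shapes dec q with AllPairs-resp-⊆ q dec
... | (b<a ∷ _) ∷ (c<b ∷ _) ∷ (d<c ∷ []) ∷ [] ∷ [] = here (ladder-relabelling d<c c<b b<a)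

increasing-shapes : ∀ {xs} → AllPairs _<_ xs → QuadShapes risingShapes xs
increasing-shapes inc q with AllPairs-resp-⊆ q inc
... | (a<b ∷ _) ∷ (b<c ∷ _) ∷ (c<d ∷ []) ∷ [] ∷ [] = here (ladder-relabelling a<b b<c c<d)

min∷decreasing-shapes : ∀ {x D} → AllPairs _>_ D → All (x <_) D →
  QuadShapes fallingShapes (x ∷ D)
min∷decreasing-shapes dec x<D (refl ∷ q) with AllPairs-resp-⊆ q dec | All-resp-⊆ q x<D
... | (c<b ∷ _) ∷ (d<c ∷ []) ∷ [] ∷ [] | _ ∷ _ ∷ x<d ∷ [] = here (ladder-relabelling x<d d<c c<b)
min∷decreasing-shapes dec x<D (_ ∷ʳ q) = there (decreasing-shapes dec q)

max∷min∷decreasing-shapes : ∀ {M x D} → AllPairs _>_ D → All (x <_) D → All (_< M) D → x < M →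
  QuadShapes fallingTopShapes (M ∷ x ∷ D)
max∷min∷decreasing-shapes dec x<D D<M x<M (refl ∷ refl ∷ q)
  with AllPairs-resp-⊆ q dec | All-resp-⊆ q x<D | All-resp-⊆ q D<M
... | (d<c ∷ []) ∷ [] ∷ [] | _ ∷ x<d ∷ [] | c<M ∷ _ = here (ladder-relabelling x<d d<c c<M)
max∷min∷decreasing-shapes dec x<D D<M x<M (refl ∷ (_ ∷ʳ q)) with AllPairs-resp-⊆ q dec | All-resp-⊆ q D<M
... | (c<b ∷ _) ∷ (d<c ∷ []) ∷ [] ∷ [] | b<M ∷ _ = there (there (here (ladder-relabelling d<c c<b b<M)))
max∷min∷decreasing-shapes dec x<D D<M x<M (_ ∷ʳ q) = there (min∷decreasing-shapes dec x<D q)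

min∷max∷increasing-shapes : ∀ {x M I} → AllPairs _<_ (x ∷ I) → All (_< M) I → x < M →
  QuadShapes risingTopShapes (x ∷ M ∷ I)
min∷max∷increasing-shapes (x<I ∷ incI) I<M x<M (refl ∷ refl ∷ q)
  with AllPairs-resp-⊆ q incI | All-resp-⊆ q x<I | All-resp-⊆ q I<M
... | (c<d ∷ []) ∷ [] ∷ [] | x<c ∷ _ | _ ∷ d<M ∷ [] = here (ladder-relabelling x<c c<d d<M)
min∷max∷increasing-shapes inc I<M x<M (refl ∷ (_ ∷ʳ q)) = there (there (increasing-shapes inc (refl ∷ q)))
min∷max∷increasing-shapes (_ ∷ incI) I<M x<M (_ ∷ʳ (refl ∷ q)) with AllPairs-resp-⊆ q incI | All-resp-⊆ q I<M
... | (b<c ∷ _) ∷ (c<d ∷ []) ∷ [] ∷ [] | _ ∷ _ ∷ d<M ∷ [] = there (here (ladder-relabelling b<c c<d d<M))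
min∷max∷increasing-shapes inc I<M x<M (_ ∷ʳ (_ ∷ʳ q)) = there (there (increasing-shapes inc (_ ∷ʳ q)))

self-shape : ∀ {w} → length w ≡ 4 → QuadShapes [ w ] w
self-shape {w} len q with refl ← ≋⇒≡ (to-≋ (sym len) q) = here (id , n<1+n , sym (map-id w))

-- In 1-based notation: [1 n … 2], [n 1 (n-1) … 2] = [1 (n-1) … 2 n], [1 2 … n], [1 n 2 … (n-1)].
falling fallingTop rising risingTop : ℕ → List ℕ
falling m    = 0 ∷ applyDownFrom suc m
fallingTop m = suc m ∷ falling m
rising m     = 0 ∷ applyUpTo suc m
risingTop m  = 0 ∷ suc m ∷ applyUpTo suc m

falling-perm : ∀ m → IsPerm (suc m) (falling m)
falling-perm m = prep 0 (↭-sym (applyUpTo↭applyDownFrom m))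

fallingTop-perm : ∀ m → IsPerm (2 + m) (fallingTop m)
fallingTop-perm m = ↭-trans (swap (suc m) 0 ↭-refl) (falling-perm (suc m))

rising-perm : ∀ m → IsPerm (suc m) (rising m)
rising-perm m = ↭-refl

risingTop-perm : ∀ m → IsPerm (2 + m) (risingTop m)
risingTop-perm m = prep 0 (↭-trans (∷↭∷ʳ (suc m) (applyUpTo suc m)) (↭-reflexive (applyUpTo-∷ʳ suc m)))

falling-shapes : ∀ m → QuadShapes fallingShapes (falling m)
falling-shapes m = min∷decreasing-shapes (decreasing-applyDownFrom m) (AllP.applyDownFrom⁺₁ suc m (λ _ → z<s))

fallingTop-shapes : ∀ m → QuadShapes fallingTopShapes (fallingTop m)
fallingTop-shapes m = max∷min∷decreasing-shapes (decreasing-applyDownFrom m) (AllP.applyDownFrom⁺₁ suc m (λ _ → z<s))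
                                                (AllP.applyDownFrom⁺₁ suc m s<s) z<s

rising-shapes : ∀ m → QuadShapes risingShapes (rising m)
rising-shapes m = increasing-shapes (AllPairsP.applyUpTo⁺₁ {R = _<_} id (suc m) (λ i<j _ → i<j))

risingTop-shapes : ∀ m → QuadShapes risingTopShapes (risingTop m)
risingTop-shapes m = min∷max∷increasing-shapes (AllPairsP.applyUpTo⁺₁ {R = _<_} id (suc m) (λ i<j _ → i<j))
                                               (AllP.applyUpTo⁺₁ suc m s<s) z<s

Π₁ Π₂ : List (List ℕ)
Π₁ = p1234 ∷ p1243 ∷ p1342 ∷ []
Π₂ = p1243 ∷ p1342 ∷ p1432 ∷ []

p1324 p1423 : List ℕ
p1324 = 0 ∷ 2 ∷ 1 ∷ 3 ∷ []
p1423 = 0 ∷ 3 ∷ 1 ∷ 2 ∷ []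

falling-avoids : ∀ m → CycAvoidsAll (p1324 ∷ Π₁) (falling m)
falling-avoids m = quadShapes-avoid (falling-shapes m) (from-yes (shapesAvoid? fallingShapes (p1324 ∷ Π₁)))

fallingTop-avoids : ∀ m → CycAvoidsAll Π₁ (fallingTop m)
fallingTop-avoids m = quadShapes-avoid (fallingTop-shapes m) (from-yes (shapesAvoid? fallingTopShapes Π₁))

rising-avoids : ∀ m → CycAvoidsAll (p1423 ∷ Π₂) (rising m)
rising-avoids m = quadShapes-avoid (rising-shapes m) (from-yes (shapesAvoid? risingShapes (p1423 ∷ Π₂)))

risingTop-avoids : ∀ m → CycAvoidsAll Π₂ (risingTop m)
risingTop-avoids m = quadShapes-avoid (risingTop-shapes m) (from-yes (shapesAvoid? risingTopShapes Π₂))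

complete₁ : ∀ j σ → IsPerm (5 + j) σ → CycAvoidsAll Π₁ σ →
            Any (RotEq σ) (falling (4 + j) ∷ fallingTop (3 + j) ∷ [])
complete₁ j σ p avoid with k , τ , e , τ↭ ← rotate-to-0 p
  with ¬c₁ ∷ ¬c₂ ∷ ¬c₃ ∷ [] ← avoids-rotate k e avoid
  with nearlyDecreasing-classify (↭-trans τ↭ (applyUpTo↭applyDownFrom (4 + j)))
                                 (avoids₁-nearlyDecreasing (unique-0∷ τ↭) ¬c₁ ¬c₂ ¬c₃)
... | inj₁ refl = here (k , e)
... | inj₂ refl = there (here (rotEq-trans (k , e) (length (falling (3 + j)) , rotate-++ (falling (3 + j)) [ 4 + j ])))

reverse-≡ : ∀ {xs ys : List ℕ} → reverse xs ≡ ys → xs ≡ reverse ys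
reverse-≡ {xs} eq = trans (sym (reverse-involutive xs)) (cong reverse eq)

complete₂ : ∀ j σ → IsPerm (5 + j) σ → CycAvoidsAll Π₂ σ →
            Any (RotEq σ) (rising (4 + j) ∷ risingTop (3 + j) ∷ [])
complete₂ j σ p avoid with k , τ , e , τ↭ ← rotate-to-0 p
  with ¬c₂ ∷ ¬c₃ ∷ ¬c₄ ∷ [] ← avoids-rotate k e avoid
  with nearlyDecreasing-classify (↭-trans (↭-reverse τ) (↭-trans τ↭ (applyUpTo↭applyDownFrom (4 + j))))
                                 (avoids₂-nearlyDecreasing (unique-0∷ τ↭) ¬c₂ ¬c₃ ¬c₄)
... | inj₁ eq = here (k , trans e (cong (0 ∷_) (trans (reverse-≡ eq) (reverse-applyDownFrom suc (4 + j)))))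
... | inj₂ eq = there (here (k , trans e (cong (0 ∷_) (begin
  τ                                                ≡⟨ reverse-≡ eq ⟩
  reverse (applyDownFrom suc (3 + j) ++ [ 4 + j ]) ≡⟨ reverse-++ (applyDownFrom suc (3 + j)) [ 4 + j ] ⟩
  4 + j ∷ reverse (applyDownFrom suc (3 + j))      ≡⟨ cong (4 + j ∷_) (reverse-applyDownFrom suc (3 + j)) ⟩
  4 + j ∷ applyUpTo suc (3 + j)                    ∎))))
  where open ≡-Reasoning

count₁-≥5 : ∀ j → NumAv Π₁ (5 + j) 2
count₁-≥5 j =
  falling (4 + j) ∷ fallingTop (3 + j) ∷ [] , refl ,
  falling-perm (4 + j) ∷ fallingTop-perm (3 + j) ∷ [] ,
  All.tail (falling-avoids (4 + j)) ∷ fallingTop-avoids (3 + j) ∷ [] ,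
  (distinct ∷ []) ∷ [] ∷ [] , complete₁ j
  where
  distinct : ¬ RotEq (falling (4 + j)) (fallingTop (3 + j))
  distinct = distinct-by-pattern (All.head (falling-avoids (4 + j)))
    (occurs 1 (refl ∷ refl ∷ refl ∷ refl ∷ []⊆-universal _) (ladder-relabelling z<s (n<1+n (2 + j)) (n<1+n (3 + j))))

count₂-≥5 : ∀ j → NumAv Π₂ (5 + j) 2
count₂-≥5 j =
  rising (4 + j) ∷ risingTop (3 + j) ∷ [] , refl ,
  rising-perm (4 + j) ∷ risingTop-perm (3 + j) ∷ [] ,
  All.tail (rising-avoids (4 + j)) ∷ risingTop-avoids (3 + j) ∷ [] ,
  (distinct ∷ []) ∷ [] ∷ [] , complete₂ j
  where
  distinct : ¬ RotEq (rising (4 + j)) (risingTop (3 + j))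
  distinct = distinct-by-pattern (All.head (rising-avoids (4 + j)))
    (occurs 0 (refl ∷ refl ∷ refl ∷ refl ∷ []⊆-universal _) (ladder-relabelling z<s (s<s z<s) (s<s (s<s z<s))))

rotationDistinct? : ∀ L → Dec (AllPairs (λ xs ys → ¬ RotEq xs ys) L)
rotationDistinct? = AllPairs.allPairs? (λ xs ys → ¬? (rotEq? xs ys))

count₁-4 : NumAv Π₁ 4 3
count₁-4 = L , refl , falling-perm 3 ∷ fallingTop-perm 2 ∷ risingTop-perm 2 ∷ [] ,
  All.tail (falling-avoids 3) ∷ fallingTop-avoids 2 ∷
    quadShapes-avoid (self-shape refl) (from-yes (shapesAvoid? [ risingTop 2 ] Π₁)) ∷ [] ,
  from-yes (rotationDistinct? L) , complete
  where
  L : List (List ℕ)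
  L = falling 3 ∷ fallingTop 2 ∷ risingTop 2 ∷ []
  complete : ∀ σ → IsPerm 4 σ → CycAvoidsAll Π₁ σ → Any (RotEq σ) L
  complete σ p (¬c₁ ∷ ¬c₂ ∷ ¬c₃ ∷ []) with rotEq-permutations p
  ... | here r                                         = ⊥-elim (¬c₁ (rotEq-cycContains r))
  ... | there (here r)                                 = there (here (rotEq-trans r (3 , refl)))
  ... | there (there (here r))                         = ⊥-elim (¬c₃ (rotEq-cycContains r))
  ... | there (there (there (here r)))                 = ⊥-elim (¬c₂ (rotEq-cycContains r))
  ... | there (there (there (there (here r))))         = there (there (here r))
  ... | there (there (there (there (there (here r))))) = here r

count₂-4 : NumAv Π₂ 4 3
count₂-4 = L , refl , rising-perm 3 ∷ risingTop-perm 2 ∷ fallingTop-perm 2 ∷ [] ,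
  All.tail (rising-avoids 3) ∷ risingTop-avoids 2 ∷
    quadShapes-avoid (self-shape refl) (from-yes (shapesAvoid? [ fallingTop 2 ] Π₂)) ∷ [] ,
  from-yes (rotationDistinct? L) , complete
  where
  L : List (List ℕ)
  L = rising 3 ∷ risingTop 2 ∷ fallingTop 2 ∷ []
  complete : ∀ σ → IsPerm 4 σ → CycAvoidsAll Π₂ σ → Any (RotEq σ) L
  complete σ p (¬c₂ ∷ ¬c₃ ∷ ¬c₄ ∷ []) with rotEq-permutations p
  ... | here r                                         = here r
  ... | there (here r)                                 = there (there (here (rotEq-trans r (3 , refl))))
  ... | there (there (here r))                         = ⊥-elim (¬c₃ (rotEq-cycContains r))
  ... | there (there (there (here r)))                 = ⊥-elim (¬c₂ (rotEq-cycContains r))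
  ... | there (there (there (there (here r))))         = there (here r)
  ... | there (there (there (there (there (here r))))) = ⊥-elim (¬c₄ (rotEq-cycContains r))

Long : List (List ℕ) → Set
Long Π = All (λ π → 4 ≤ length π) Π

long₁ : Long Π₁
long₁ = ≤-refl ∷ ≤-refl ∷ ≤-refl ∷ []

long₂ : Long Π₂
long₂ = ≤-refl ∷ ≤-refl ∷ ≤-refl ∷ []

count-0 : ∀ {Π} → Long Π → NumAv Π 0 1
count-0 {Π} long =
  [ [] ] , refl , ↭-refl ∷ [] , All.map (λ {π} 4≤π → short-avoids {[]} {π} (<-≤-trans z<s 4≤π)) long ∷ [] ,
  [] ∷ [] , complete
  where
  complete : ∀ σ → IsPerm 0 σ → CycAvoidsAll Π σ → Any (RotEq σ) [ [] ]
  complete σ p _ with refl ← ↭-empty-inv p = here (0 , refl)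

normalForms : ℕ → List (List ℕ)
normalForms m = map (0 ∷_) (permutations (applyUpTo suc m))

count-short : ∀ {Π} m → m ≤ 2 → Long Π → AllPairs (λ xs ys → ¬ RotEq xs ys) (normalForms m) →
              NumAv Π (suc m) (length (normalForms m))
count-short {Π} m m≤2 long distinct =
  normalForms m , refl ,
  AllP.map⁺ (All.tabulate λ τ∈ → prep 0 (permutations-↭ (applyUpTo suc m) τ∈)) ,
  AllP.map⁺ (All.tabulate λ {τ} τ∈ → All.map (λ {π} 4≤π → short-avoids {0 ∷ τ} {π} (short {τ} {π} τ∈ 4≤π)) long) ,
  distinct , λ σ p _ → AnyP.map⁺ (rotEq-permutations p)
  where
  short : ∀ {τ π : List ℕ} → τ ∈ permutations (applyUpTo suc m) → 4 ≤ length π → length (0 ∷ τ) < length π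
  short {π = π} τ∈ 4≤π =
    subst (_< length π) (cong suc (sym (trans (↭-length (permutations-↭ (applyUpTo suc m) τ∈)) (length-applyUpTo suc m))))
          (≤-trans (s≤s (s≤s m≤2)) 4≤π)

count-short-both : ∀ m → m ≤ 2 → AllPairs (λ xs ys → ¬ RotEq xs ys) (normalForms m) →
                   ∃ λ k → NumAv Π₁ (suc m) k × NumAv Π₂ (suc m) k
count-short-both m m≤2 distinct = _ , count-short m m≤2 long₁ distinct , count-short m m≤2 long₂ distinct

mainTheorem10 :
    (∀ (n : ℕ) → ∃ λ k →
        NumAv (p1234 ∷ p1243 ∷ p1342 ∷ []) n k
      × NumAv (p1243 ∷ p1342 ∷ p1432 ∷ []) n k)
    × (∀ (n : ℕ) → 5 ≤ n → NumAv (p1234 ∷ p1243 ∷ p1342 ∷ []) n 2)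
mainTheorem10 = equinumerous , atLeast5
  where
  equinumerous : ∀ n → ∃ λ k → NumAv Π₁ n k × NumAv Π₂ n k
  equinumerous 0 = 1 , count-0 long₁ , count-0 long₂
  equinumerous 1 = count-short-both 0 z≤n (from-yes (rotationDistinct? (normalForms 0)))
  equinumerous 2 = count-short-both 1 (s≤s z≤n) (from-yes (rotationDistinct? (normalForms 1)))
  equinumerous 3 = count-short-both 2 (s≤s (s≤s z≤n)) (from-yes (rotationDistinct? (normalForms 2)))
  equinumerous 4 = 3 , count₁-4 , count₂-4
  equinumerous (suc (suc (suc (suc (suc j))))) = 2 , count₁-≥5 j , count₂-≥5 j

  atLeast5 : ∀ n → 5 ≤ n → NumAv Π₁ n 2
  atLeast5 n 5≤n with j , refl ← m≤n⇒∃[o]m+o≡n 5≤n = count₁-≥5 j
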